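{- Let $G$ be a finite, simple, connected graph with $n$ vertices, chromatic number $\chi$, and metric dimension $\beta$, and suppose the alikeness relation partitions its vertex set into $s$ equivalence classes. Then $$\beta \leq \left\lfloor \frac{\chi - 1}{\chi}\, n \right\rfloor + n - s.$$
   Context: Two vertices are alike if they have the same set of neighbors (an equivalence relation). A vertex $u$ resolves two vertices $v,w$ if $d(u,v) \neq d(u,w)$, where $d$ is the graph distance. A resolving set is a set $W$ of vertices such that every pair of distinct vertices is resolved by some vertex of $W$; the metric dimension $\beta$ is the minimum size of a resolving set. -}

module Defs where

open import Data.Nat using (ℕ; zero; suc; _≤_; _<_)
open import Data.Fin using (Fin)
open import Data.Fin.Subset using (Subset; _∈_; ∣_∣)
open import Data.Product using (Σ; _×_; _,_; ∃; ∃-syntax)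
open import Relation.Binary.PropositionalEquality using (_≡_; _≢_)
open import Relation.Nullary using (¬_)

record Graph (n : ℕ) : Set₁ where
  field
    Adj     : Fin n → Fin n → Set
    sym     : ∀ {u v} → Adj u v → Adj v u
    irrefl  : ∀ {u} → ¬ Adj u u

module _ {n : ℕ} (G : Graph n) where
  open Graph G

  data Walk : Fin n → Fin n → ℕ → Set where
    [] : ∀ {u} → Walk u u zero
    _∷_ : ∀ {u v w k} → Adj u v → Walk v w k → Walk u w (suc k)

  Connected : Set
  Connected = ∀ u v → ∃[ k ] Walk u v k

  Dist : Fin n → Fin n → ℕ → Set
  Dist u v k = Walk u v k × (∀ j → Walk u v j → k ≤ j)

  Resolves : Fin n → Fin n → Fin n → Set
  Resolves u v w = ∀ a b → Dist u v a → Dist u w b → a ≢ b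

  ResolvingSet : Subset n → Set
  ResolvingSet W = ∀ v w → v ≢ w → Σ (Fin n) λ u → u ∈ W × Resolves u v w

  IsMetricDimension : ℕ → Set
  IsMetricDimension β =
    (Σ (Subset n) λ W → ResolvingSet W × ∣ W ∣ ≡ β)
    × (∀ W → ResolvingSet W → β ≤ ∣ W ∣)

  ProperColouring : (k : ℕ) → (Fin n → Fin k) → Set
  ProperColouring k c = ∀ u v → Adj u v → c u ≢ c v

  IsChromaticNumber : ℕ → Set
  IsChromaticNumber χ =
    (Σ (Fin n → Fin χ) (ProperColouring χ))
    × (∀ k (c : Fin n → Fin k) → ProperColouring k c → χ ≤ k)

  Alike : Fin n → Fin n → Set
  Alike u v = ∀ w → (Adj u w → Adj v w) × (Adj v w → Adj u w)

  -- the alikeness relation has exactly s equivalence classes: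
  -- there is a set of s representatives, one per class
  NumAlikeClasses : ℕ → Set
  NumAlikeClasses s = Σ (Subset n) λ R →
      ∣ R ∣ ≡ s
    × (∀ v → Σ (Fin n) λ r → r ∈ R × Alike v r)
    × (∀ r r′ → r ∈ R → r′ ∈ R → Alike r r′ → r ≡ r′)

module Submission where

-- Idea.  Let I be a largest colour class of a proper χ-colouring (so
-- n ≤ χ·∣I∣, by averaging over the colour classes) and let R be a set of
-- representatives of the s alikeness classes.  Then every vertex outside
-- I ∩ R, i.e. the set W = ∁ I ∪ ∁ R, forms a resolving set:  a pair
-- containing a vertex of W is resolved by that vertex itself, and two
-- distinct vertices v, w of I ∩ R are not alike, so some x is adjacent to
-- exactly one of them; x lies outside the independent set I, and it sees
-- one of v, w at distance 1 and the other one not.  Hence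
--   β ≤ ∣W∣ ≤ (n - ∣I∣) + (n - s) ≤ ⌊(χ-1)n/χ⌋ + n - s.
-- Adjacency is an arbitrary relation, but since the conclusion is a
-- decidable inequality we may assume adjacency decidable (double negation).

open import Defs
open import Data.Nat using (ℕ; zero; suc; z≤n; s≤s; _≤_; _<_; _≤?_; _+_; _*_; _∸_; NonZero)
open import Data.Nat.Properties
open import Data.Nat.DivMod using (_/_; m*n/n≡m; /-monoˡ-≤)
open import Data.Bool using (Bool; true; false)
open import Data.Fin using (Fin; zero; suc)
open import Data.Fin.Properties using (¬∀⟶∃¬)
open import Data.Fin.Subset using (Subset; ∣_∣; _∈_; _∉_; ∁; _∪_; ⁅_⁆)
open import Data.Fin.Subset.Properties
  using (_∈?_; x∈p∪q⁺; x∉∁p⇒x∈p; x∉p⇒x∈∁p; x∈⁅y⁆⇒x≡y; ∣⁅x⁆∣≡1; ∣∁p∣≡n∸∣p∣; ∣p∣≤n)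
open import Data.Vec using ([]; _∷_; tabulate; lookup)
open import Data.Vec.Properties using ([]=⇒lookup; lookup⇒[]=; lookup∘tabulate; tabulate∘lookup)
open import Data.Product using (_×_; _,_; ∃-syntax)
open import Data.Sum using (_⊎_; inj₁; inj₂; [_,_])
open import Data.Empty using (⊥-elim)
open import Relation.Nullary using (¬_; Dec; yes; no)
open import Relation.Nullary.Negation.Core using (¬¬-map)
open import Relation.Nullary.Decidable using (decidable-stable; ¬¬-excluded-middle; _×-dec_; _→-dec_)
open import Relation.Binary.PropositionalEquality using (_≡_; _≢_; refl; sym; trans; cong; cong₂; subst; module ≡-Reasoning)
open import Function using (_∘_; const)
open import Algebra.Properties.CommutativeMonoid.Sum +-0-commutativeMonoid
  using (sum; sum-syntax; sum-cong-≗; ∑-comm)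

𝟙 : Bool → ℕ
𝟙 true  = 1
𝟙 false = 0

∣tabulate∣≡∑ : ∀ {n} (f : Fin n → Bool) → ∣ tabulate f ∣ ≡ ∑[ v < n ] 𝟙 (f v)
∣tabulate∣≡∑ {zero}  f = refl
∣tabulate∣≡∑ {suc n} f with f zero
... | true  = cong suc (∣tabulate∣≡∑ (f ∘ suc))
... | false = ∣tabulate∣≡∑ (f ∘ suc)

∑-ones : ∀ n → ∑[ v < n ] 1 ≡ n
∑-ones zero    = refl
∑-ones (suc n) = cong suc (∑-ones n)

double-counting : ∀ {m k} (M : Fin m → Fin k → Bool) →
  ∑[ i < k ] ∣ tabulate (λ v → M v i) ∣ ≡ ∑[ v < m ] ∣ tabulate (M v) ∣
double-counting {m} {k} M = begin
  ∑[ i < k ] ∣ tabulate (λ v → M v i) ∣  ≡⟨ sum-cong-≗ (λ i → ∣tabulate∣≡∑ (λ v → M v i)) ⟩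
  ∑[ i < k ] ∑[ v < m ] 𝟙 (M v i)        ≡⟨ ∑-comm (λ i v → 𝟙 (M v i)) ⟩
  ∑[ v < m ] ∑[ i < k ] 𝟙 (M v i)        ≡⟨ sum-cong-≗ (λ v → ∣tabulate∣≡∑ (M v)) ⟨
  ∑[ v < m ] ∣ tabulate (M v) ∣          ∎
  where open ≡-Reasoning

∃-above-average : ∀ {k} (f : Fin (suc k) → ℕ) → ∃[ i ] sum f ≤ suc k * f i
∃-above-average {zero} f = zero , ≤-refl
∃-above-average {suc k} f with ∃-above-average (f ∘ suc)
... | j , rest≤ with f zero ≤? f (suc j)
...   | yes f₀≤fⱼ = suc j , +-mono-≤ f₀≤fⱼ rest≤
...   | no  f₀≰fⱼ = zero , +-monoʳ-≤ (f zero)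
                      (≤-trans rest≤ (*-monoʳ-≤ (suc k) (<⇒≤ (≰⇒> f₀≰fⱼ))))

∣p∪q∣≤∣p∣+∣q∣ : ∀ {n} (p q : Subset n) → ∣ p ∪ q ∣ ≤ ∣ p ∣ + ∣ q ∣
∣p∪q∣≤∣p∣+∣q∣ []          []          = z≤n
∣p∪q∣≤∣p∣+∣q∣ (true ∷ p)  (true ∷ q)  = s≤s (≤-trans (∣p∪q∣≤∣p∣+∣q∣ p q) (+-monoʳ-≤ ∣ p ∣ (n≤1+n ∣ q ∣)))
∣p∪q∣≤∣p∣+∣q∣ (true ∷ p)  (false ∷ q) = s≤s (∣p∪q∣≤∣p∣+∣q∣ p q)
∣p∪q∣≤∣p∣+∣q∣ (false ∷ p) (true ∷ q)  = ≤-trans (s≤s (∣p∪q∣≤∣p∣+∣q∣ p q)) (≤-reflexive (sym (+-suc ∣ p ∣ ∣ q ∣)))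
∣p∪q∣≤∣p∣+∣q∣ (false ∷ p) (false ∷ q) = ∣p∪q∣≤∣p∣+∣q∣ p q

∉∁∪∁ : ∀ {n} {x : Fin n} (p q : Subset n) → x ∉ ∁ p ∪ ∁ q → x ∈ p × x ∈ q
∉∁∪∁ p q x∉ = x∉∁p⇒x∈p (x∉ ∘ x∈p∪q⁺ ∘ inj₁) , x∉∁p⇒x∈p (x∉ ∘ x∈p∪q⁺ ∘ inj₂)

¬¬-∀-Fin : ∀ {n} {P : Fin n → Set} → (∀ i → ¬ ¬ P i) → ¬ ¬ (∀ i → P i)
¬¬-∀-Fin {zero}  ¬¬P ¬∀ = ¬∀ (λ ())
¬¬-∀-Fin {suc n} ¬¬P ¬∀ = ¬¬P zero λ P₀ → ¬¬-∀-Fin (¬¬P ∘ suc) λ Pₛ →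
  ¬∀ λ { zero → P₀ ; (suc i) → Pₛ i }

-- The vertices receiving colour i under c; the matrix entry (v , i) is
-- "i is the colour of v".
colourClass : ∀ {n k} → (Fin n → Fin k) → Fin k → Subset n
colourClass c i = tabulate (λ v → lookup ⁅ c v ⁆ i)

∈-colourClass : ∀ {n k} {c : Fin n → Fin k} {i v} → v ∈ colourClass c i → i ≡ c v
∈-colourClass {c = c} {i} {v} v∈ = x∈⁅y⁆⇒x≡y (c v) (lookup⇒[]= i ⁅ c v ⁆ (begin
  lookup ⁅ c v ⁆ i                                ≡⟨ lookup∘tabulate (λ u → lookup ⁅ c u ⁆ i) v ⟨
  lookup (colourClass c i) v                      ≡⟨ []=⇒lookup v∈ ⟩
  true                                            ∎))
  where open ≡-Reasoning

colourClasses-partition : ∀ {n k} (c : Fin n → Fin k) → ∑[ i < k ] ∣ colourClass c i ∣ ≡ n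
colourClasses-partition {n} c = begin
  ∑[ i < _ ] ∣ colourClass c i ∣                 ≡⟨ double-counting (λ v → lookup ⁅ c v ⁆) ⟩
  ∑[ v < n ] ∣ tabulate (lookup ⁅ c v ⁆) ∣       ≡⟨ sum-cong-≗ (λ v → cong ∣_∣ (tabulate∘lookup ⁅ c v ⁆)) ⟩
  ∑[ v < n ] ∣ ⁅ c v ⁆ ∣                         ≡⟨ sum-cong-≗ (λ v → ∣⁅x⁆∣≡1 (c v)) ⟩
  ∑[ v < n ] 1                                   ≡⟨ ∑-ones n ⟩
  n                                              ∎
  where open ≡-Reasoning

largest-colourClass : ∀ {n k} (c : Fin n → Fin (suc k)) → ∃[ i ] n ≤ suc k * ∣ colourClass c i ∣
largest-colourClass c with ∃-above-average (∣_∣ ∘ colourClass c)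
... | i , sum≤ = i , ≤-trans (≤-reflexive (sym (colourClasses-partition c))) sum≤

module _ {n : ℕ} (G : Graph n) where
  open Graph G renaming (sym to adj-sym)

  walk₀⇒≡ : ∀ {u v} → Walk G u v 0 → u ≡ v
  walk₀⇒≡ [] = refl

  dist-self : ∀ {u a} → Dist G u u a → a ≡ 0
  dist-self (_ , shortest) = n≤0⇒n≡0 (shortest 0 [])

  dist-adj : ∀ {u v a} → Adj u v → Dist G u v a → a ≡ 1
  dist-adj {a = zero}        uv (walk , _)     with refl ← walk₀⇒≡ walk = ⊥-elim (irrefl uv)
  dist-adj {a = suc zero}    uv _              = refl
  dist-adj {a = suc (suc a)} uv (_ , shortest) with shortest 1 (uv ∷ [])
  ... | s≤s ()

  dist₁⇒adj : ∀ {u v} → Dist G u v 1 → Adj u v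
  dist₁⇒adj (uv ∷ rest , _) with refl ← walk₀⇒≡ rest = uv

  resolves-sym : ∀ {u v w} → Resolves G u v w → Resolves G u w v
  resolves-sym res a b da db a≡b = res b a db da (sym a≡b)

  resolves-self : ∀ {v w} → v ≢ w → Resolves G v v w
  resolves-self v≢w a b dv (walk , _) a≡b with refl ← dist-self dv | refl ← a≡b =
    v≢w (walk₀⇒≡ walk)

  resolves-neighbour : ∀ {v w x} → Adj v x → ¬ Adj w x → Resolves G x v w
  resolves-neighbour vx ¬wx a b dv dw a≡b with refl ← dist-adj (adj-sym vx) dv | refl ← a≡b =
    ¬wx (adj-sym (dist₁⇒adj dw))

  resolved-by-neighbour : (∀ u v → Dec (Adj u v)) → ∀ {v w} → ¬ Alike G v w →
    ∃[ x ] (Adj v x ⊎ Adj w x) × Resolves G x v w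
  resolved-by-neighbour dec {v} {w} ¬alike
    with ¬∀⟶∃¬ n _ (λ x → (dec v x →-dec dec w x) ×-dec (dec w x →-dec dec v x)) ¬alike
  ... | x , ¬same with dec v x | dec w x
  ...   | yes vx | yes wx = ⊥-elim (¬same (const wx , const vx))
  ...   | yes vx | no ¬wx = x , inj₁ vx , resolves-neighbour vx ¬wx
  ...   | no ¬vx | yes wx = x , inj₂ wx , resolves-sym (resolves-neighbour wx ¬vx)
  ...   | no ¬vx | no ¬wx = ⊥-elim (¬same ((⊥-elim ∘ ¬vx) , (⊥-elim ∘ ¬wx)))

  Independent : Subset n → Set
  Independent I = ∀ {u v} → u ∈ I → v ∈ I → ¬ Adj u v

  AlikeDistinct : Subset n → Set
  AlikeDistinct R = ∀ r r′ → r ∈ R → r′ ∈ R → Alike G r r′ → r ≡ r′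

  outside-resolving : (∀ u v → Dec (Adj u v)) → ∀ {I R} →
    Independent I → AlikeDistinct R → ResolvingSet G (∁ I ∪ ∁ R)
  outside-resolving dec {I} {R} indep distinct v w v≢w with v ∈? ∁ I ∪ ∁ R | w ∈? ∁ I ∪ ∁ R
  ... | yes v∈W | _       = v , v∈W , resolves-self v≢w
  ... | no _    | yes w∈W = w , w∈W , resolves-sym (resolves-self (v≢w ∘ sym))
  ... | no v∉W  | no w∉W
    with ∉∁∪∁ I R v∉W | ∉∁∪∁ I R w∉W
  ... | v∈I , v∈R | w∈I , w∈R
    with resolved-by-neighbour dec (v≢w ∘ distinct v w v∈R w∈R)
  ... | x , vx⊎wx , res = x , x∈p∪q⁺ (inj₁ (x∉p⇒x∈∁p x∉I)) , res
    where
    x∉I : x ∉ I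
    x∉I x∈I = [ indep v∈I x∈I , indep w∈I x∈I ] vx⊎wx

  colourClass-independent : ∀ {k c} → ProperColouring G k c → ∀ i → Independent (colourClass c i)
  colourClass-independent {c = c} proper i u∈ v∈ uv =
    proper _ _ uv (trans (sym (∈-colourClass {c = c} u∈)) (∈-colourClass {c = c} v∈))

  -- Adjacency is decidable up to double negation, which suffices for a
  -- decidable conclusion such as an inequality of naturals.
  ¬¬-decidable-adjacency : ¬ ¬ (∀ u v → Dec (Adj u v))
  ¬¬-decidable-adjacency = ¬¬-∀-Fin λ u → ¬¬-∀-Fin λ v → ¬¬-excluded-middle

n∸m≤⌊χ-1/χ·n⌋ : ∀ n m χ .{{_ : NonZero χ}} → n ≤ χ * m → n ∸ m ≤ ((χ ∸ 1) * n) / χ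
n∸m≤⌊χ-1/χ·n⌋ n m (suc k) n≤χm = begin
  n ∸ m                     ≡⟨ m*n/n≡m (n ∸ m) (suc k) ⟨
  (n ∸ m) * suc k / suc k   ≤⟨ /-monoˡ-≤ (suc k) scaled ⟩
  (k * n) / suc k           ∎
  where
  open ≤-Reasoning
  scaled : (n ∸ m) * suc k ≤ k * n
  scaled = begin
    (n ∸ m) * suc k        ≡⟨ *-comm (n ∸ m) (suc k) ⟩
    suc k * (n ∸ m)        ≡⟨ *-distribˡ-∸ (suc k) n m ⟩
    suc k * n ∸ suc k * m  ≤⟨ ∸-monoʳ-≤ (suc k * n) n≤χm ⟩
    n + k * n ∸ n          ≡⟨ m+n∸m≡n n (k * n) ⟩
    k * n                  ∎

lemma7 : (n : ℕ) → 0 < n → (G : Graph n) → Connected G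
    → (χ β s : ℕ) → .{{_ : NonZero χ}}
    → IsChromaticNumber G χ → IsMetricDimension G β → NumAlikeClasses G s
    → β ≤ ((χ ∸ 1) * n) / χ + n ∸ s
lemma7 n _ G _ χ@(suc k) β s ((c , proper) , _) (_ , minimal) (R , ∣R∣≡s , _ , distinct) =
  decidable-stable (β ≤? bound) (¬¬-map bounded (¬¬-decidable-adjacency G))
  where
  bound : ℕ
  bound = ((χ ∸ 1) * n) / χ + n ∸ s

  bounded : (∀ u v → Dec (Graph.Adj G u v)) → β ≤ bound
  bounded dec with largest-colourClass c
  ... | i , large = begin
    β                                   ≤⟨ minimal W (outside-resolving G dec (colourClass-independent G proper i) distinct) ⟩
    ∣ W ∣                               ≤⟨ ∣p∪q∣≤∣p∣+∣q∣ (∁ I) (∁ R) ⟩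
    ∣ ∁ I ∣ + ∣ ∁ R ∣                   ≡⟨ cong₂ _+_ (∣∁p∣≡n∸∣p∣ I) (trans (∣∁p∣≡n∸∣p∣ R) (cong (n ∸_) ∣R∣≡s)) ⟩
    (n ∸ ∣ I ∣) + (n ∸ s)               ≤⟨ +-monoˡ-≤ (n ∸ s) (n∸m≤⌊χ-1/χ·n⌋ n ∣ I ∣ χ large) ⟩
    ((χ ∸ 1) * n) / χ + (n ∸ s)         ≡⟨ +-∸-assoc (((χ ∸ 1) * n) / χ) s≤n ⟨
    bound                               ∎
    where
    open ≤-Reasoning
    I W : Subset n
    I = colourClass c i
    W = ∁ I ∪ ∁ R
    s≤n : s ≤ n
    s≤n = subst (_≤ n) ∣R∣≡s (∣p∣≤n R)
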